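{- Let $P$ be a connected finite poset with at least two points and let $C$ be a 4-crown (not necessarily contained in $P$) with $L(C)=\{a,b\}$, $U(C)=\{v,w\}$. There exists a surjective order homomorphism $f:P\to C$ if and only if there exist a partition of $L(P)$ into two nonempty sets $A,B$ and a partition of $U(P)$ into two nonempty sets $V,W$ such that: whenever $F\subseteq E(P)$ is a four-element set with $F\cap N\neq\emptyset$ for all $N\in\{A,B,V,W\}$, $F$ is not an improper 4-crown in $E(P)$. Moreover, if $C\subseteq E(P)$, then $C$ is a retract of $P$ if and only if there exist such partitions satisfying this condition in which the four points $a,b,v,w$ all belong to different sets among $A,B,V,W$.
   Context: Subsets are identified with induced subposets. $L(P)$, $U(P)$: minimal and maximal points; $E(P)=L(P)\cup U(P)$. $[x,y]_P=\{z:x\leq_P z\leq_P y\}$. A subset is a crown if its comparability graph (edges between distinct comparable elements) is a cycle; a 4-crown $D=\{a',b',v',w'\}$ with $L(D)=\{a',b'\}$, $U(D)=\{v',w'\}$ is improper if $[a',v']_P\cap[b',w']_P\neq\emptyset$. A retraction is an idempotent order homomorphism $r:P\to P$; its image is a retract. -}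

module Defs where

open import Data.Nat using (ℕ)
open import Data.Fin using (Fin)
open import Data.Fin.Subset using (Subset; _∈_; Nonempty)
open import Data.Product using (Σ; ∃; _×_; _,_)
open import Data.Sum using (_⊎_)
open import Data.Empty using (⊥)
open import Relation.Nullary using (¬_)
open import Relation.Binary.PropositionalEquality using (_≡_; _≢_)
open import Relation.Binary.Construct.Closure.ReflexiveTransitive using (Star)

-- Throughout, a finite poset P is the set Fin n with an order relation _≤_
-- (assumed to be a partial order w.r.t. _≡_ in the statement).

module _ {n : ℕ} (_≤_ : Fin n → Fin n → Set) where

  _<_ : Fin n → Fin n → Set
  x < y = x ≤ y × x ≢ y

  Comp : Fin n → Fin n → Set
  Comp x y = x ≤ y ⊎ y ≤ x

  Connected : Set
  Connected = ∀ x y → Star Comp x y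

  InL : Fin n → Set
  InL x = ∀ y → y ≤ x → y ≡ x

  InU : Fin n → Set
  InU x = ∀ y → x ≤ y → y ≡ x

  InE : Fin n → Set
  InE x = InL x ⊎ InU x

  IsCrown4 : Fin n → Fin n → Fin n → Fin n → Set
  IsCrown4 a' b' v' w' =
    (a' ≢ b' × a' ≢ v' × a' ≢ w' × b' ≢ v' × b' ≢ w' × v' ≢ w')
    × (a' ≤ v' × a' ≤ w' × b' ≤ v' × b' ≤ w')
    × ¬ Comp a' b' × ¬ Comp v' w'

  ImproperCrown4 : Fin n → Fin n → Fin n → Fin n → Set
  ImproperCrown4 a' b' v' w' =
    IsCrown4 a' b' v' w'
    × ∃ λ z → (a' ≤ z × z ≤ v') × (b' ≤ z × z ≤ w')

  IsPartition₂ : (Fin n → Set) → Subset n → Subset n → Set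
  IsPartition₂ S A B =
    (∀ x → x ∈ A → S x) × (∀ x → x ∈ B → S x)
    × (∀ x → S x → x ∈ A ⊎ x ∈ B)
    × (∀ x → x ∈ A → x ∈ B → ⊥)
    × Nonempty A × Nonempty B

  Meets : Fin n → Fin n → Fin n → Fin n → Subset n → Set
  Meets a' b' v' w' N = a' ∈ N ⊎ b' ∈ N ⊎ v' ∈ N ⊎ w' ∈ N

  NoImproperCrown : Subset n → Subset n → Subset n → Subset n → Set
  NoImproperCrown A B V W =
    ∀ a' b' v' w' → InE a' → InE b' → InE v' → InE w'
    → Meets a' b' v' w' A → Meets a' b' v' w' B
    → Meets a' b' v' w' V → Meets a' b' v' w' W
    → ¬ ImproperCrown4 a' b' v' w'

  GoodPartition : Subset n → Subset n → Subset n → Subset n → Set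
  GoodPartition A B V W =
    IsPartition₂ InL A B × IsPartition₂ InU V W × NoImproperCrown A B V W

  SameSet : Subset n → Subset n → Subset n → Subset n → Fin n → Fin n → Set
  SameSet A B V W x y =
    (x ∈ A × y ∈ A) ⊎ (x ∈ B × y ∈ B) ⊎ (x ∈ V × y ∈ V) ⊎ (x ∈ W × y ∈ W)

  AllDifferent : Subset n → Subset n → Subset n → Subset n
               → Fin n → Fin n → Fin n → Fin n → Set
  AllDifferent A B V W a b v w =
    ¬ S a b × ¬ S a v × ¬ S a w × ¬ S b v × ¬ S b w × ¬ S v w
    where S = SameSet A B V W

  Monotone : (Fin n → Fin n) → Set
  Monotone r = ∀ {x y} → x ≤ y → r x ≤ r y

  IsRetractOf4 : Fin n → Fin n → Fin n → Fin n → Set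
  IsRetractOf4 a b v w =
    Σ (Fin n → Fin n) λ r →
      Monotone r × (∀ x → r (r x) ≡ r x)
      × (∀ y → (∃ λ x → r x ≡ y) → y ≡ a ⊎ y ≡ b ⊎ y ≡ v ⊎ y ≡ w)
      × (∀ y → (y ≡ a ⊎ y ≡ b ⊎ y ≡ v ⊎ y ≡ w) → ∃ λ x → r x ≡ y)

data Crown : Set where
  ca cb cv cw : Crown

data _≤C_ : Crown → Crown → Set where
  ≤C-refl : ∀ {x} → x ≤C x
  a≤v : ca ≤C cv
  a≤w : ca ≤C cw
  b≤v : cb ≤C cv
  b≤w : cb ≤C cw

SurjHomToCrown : {n : ℕ} → (Fin n → Fin n → Set) → Set
SurjHomToCrown {n} _≤_ =
  Σ (Fin n → Crown) λ f →
    (∀ {x y} → x ≤ y → f x ≤C f y) × (∀ c → ∃ λ x → f x ≡ c)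

-- A surjection f : P → C splits L(P) by whether f x = b and U(P) by whether
-- f x = w. No improper crown meets all four classes: if z lies above a', b'
-- and below v', w', then in C either f a' = f b' = f z or f v' = f w' = f z.
-- Conversely, keep the labels of the points of V and W, and send any other
-- point to a or b if it lies over only B or only A; a point over both A and B
-- lies under only one of V, W (otherwise an improper crown appears) and goes
-- to that top. A retraction onto a crown {a,b,v,w} ⊆ E(P) is such a surjection
-- followed by the inclusion C ≅ {a,b,v,w}, with a, b, v, w in distinct classes.
module Submission where

open import Defs
open import Data.Nat using (ℕ; _≤_; s≤s)
open import Data.Fin using (Fin; zero; punchIn)
open import Data.Fin.Properties using (any?; all?; punchInᵢ≢i) renaming (_≟_ to _≟ᶠ_)
open import Data.Fin.Induction using (po-wellFounded)
open import Data.Fin.Subset using (Subset; _∈_; _∉_; Nonempty)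
open import Data.Fin.Subset.Properties using (_∈?_)
open import Data.Bool.Properties using (T-≡)
open import Data.Product using (Σ; ∃; _×_; _,_; proj₁; proj₂)
open import Data.Sum using (_⊎_; inj₁; inj₂; map; map₁; map₂; swap; assocʳ; assocˡ; reduce; fromInj₁; fromInj₂)
open import Data.Empty using (⊥; ⊥-elim)
open import Data.Vec using (tabulate)
open import Data.Vec.Properties using (lookup∘tabulate; []=⇒lookup; lookup⇒[]=)
open import Function using (_∘_; flip)
open import Function.Bundles using (_⇔_; mk⇔; module Equivalence)
open import Induction.WellFounded using (Acc; acc)
open import Relation.Nullary using (¬_; Dec; yes; no)
open import Relation.Nullary.Decidable using (isYes; toWitness; fromWitness; toSum; decidable-stable; _×-dec_; _→-dec_; ¬?)
open import Relation.Unary using () renaming (Decidable to Decidable₁)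
open import Relation.Binary.PropositionalEquality using (_≡_; _≢_; refl; sym; trans; cong; subst; subst₂)
open import Relation.Binary.Definitions using (Decidable)
open import Relation.Binary.Structures using (IsPartialOrder)
import Relation.Binary.Construct.Flip.EqAndOrd as Flip
open import Relation.Binary.Construct.Closure.ReflexiveTransitive using (Star; ε; _◅_)

module _ {n : ℕ} {P : Fin n → Set} (P? : Decidable₁ P) where

  subset : Subset n
  subset = tabulate (isYes ∘ P?)

  ∈-subset⁺ : ∀ {x} → P x → x ∈ subset
  ∈-subset⁺ {x} px =
    lookup⇒[]= x subset (trans (lookup∘tabulate (isYes ∘ P?) x) (Equivalence.to T-≡ (fromWitness px)))

  ∈-subset⁻ : ∀ {x} → x ∈ subset → P x
  ∈-subset⁻ {x} x∈ =
    toWitness (Equivalence.from T-≡ (trans (sym (lookup∘tabulate (isYes ∘ P?) x)) ([]=⇒lookup x∈)))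

split-pair : ∀ {P₁ Q₁ P₂ Q₂ : Set} → P₁ ⊎ Q₁ → P₂ ⊎ Q₂ → ¬ (P₁ × P₂) → ¬ (Q₁ × Q₂)
           → (P₁ × Q₂) ⊎ (Q₁ × P₂)
split-pair (inj₁ p₁) (inj₁ p₂) ¬pp _   = ⊥-elim (¬pp (p₁ , p₂))
split-pair (inj₁ p₁) (inj₂ q₂) _   _   = inj₁ (p₁ , q₂)
split-pair (inj₂ q₁) (inj₁ p₂) _   _   = inj₂ (q₁ , p₂)
split-pair (inj₂ q₁) (inj₂ q₂) _   ¬qq = ⊥-elim (¬qq (q₁ , q₂))

split-absurd : ∀ {A : Set} {x y z : A} → x ≡ y → x ≢ z ⊎ y ≢ z → x ≡ z ⊎ y ≡ z → ⊥
split-absurd refl x≢z x≡z = reduce x≢z (reduce x≡z)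

swap₁₂ : ∀ {P Q R : Set} → P ⊎ Q ⊎ R → Q ⊎ P ⊎ R
swap₁₂ = assocʳ ∘ map₁ swap ∘ assocˡ

swap₃₄ : ∀ {P Q R S : Set} → P ⊎ Q ⊎ R ⊎ S → P ⊎ Q ⊎ S ⊎ R
swap₃₄ = map₂ (map₂ swap)

data Lower : Crown → Set where
  ca-lower : Lower ca
  cb-lower : Lower cb

data Upper : Crown → Set where
  cv-upper : Upper cv
  cw-upper : Upper cw

level : ∀ c → Lower c ⊎ Upper c
level ca = inj₁ ca-lower
level cb = inj₁ cb-lower
level cv = inj₂ cv-upper
level cw = inj₂ cw-upper

_≟ᶜ_ : (c d : Crown) → Dec (c ≡ d)
ca ≟ᶜ ca = yes refl
ca ≟ᶜ cb = no λ ()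
ca ≟ᶜ cv = no λ ()
ca ≟ᶜ cw = no λ ()
cb ≟ᶜ ca = no λ ()
cb ≟ᶜ cb = yes refl
cb ≟ᶜ cv = no λ ()
cb ≟ᶜ cw = no λ ()
cv ≟ᶜ ca = no λ ()
cv ≟ᶜ cb = no λ ()
cv ≟ᶜ cv = yes refl
cv ≟ᶜ cw = no λ ()
cw ≟ᶜ ca = no λ ()
cw ≟ᶜ cb = no λ ()
cw ≟ᶜ cv = no λ ()
cw ≟ᶜ cw = yes refl

≤C-reflexive : ∀ {c d} → c ≡ d → c ≤C d
≤C-reflexive refl = ≤C-refl

≤C-antisym : ∀ {c d} → c ≤C d → d ≤C c → c ≡ d
≤C-antisym ≤C-refl _ = refl
≤C-antisym a≤v ()
≤C-antisym a≤w ()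
≤C-antisym b≤v ()
≤C-antisym b≤w ()

lower≤upper : ∀ {c d} → Lower c → Upper d → c ≤C d
lower≤upper ca-lower cv-upper = a≤v
lower≤upper ca-lower cw-upper = a≤w
lower≤upper cb-lower cv-upper = b≤v
lower≤upper cb-lower cw-upper = b≤w

≤lower⇒≡ : ∀ {c d} → Lower d → c ≤C d → c ≡ d
≤lower⇒≡ ca-lower ≤C-refl = refl
≤lower⇒≡ cb-lower ≤C-refl = refl

upper≤⇒≡ : ∀ {c d} → Upper c → c ≤C d → d ≡ c
upper≤⇒≡ cv-upper ≤C-refl = refl
upper≤⇒≡ cw-upper ≤C-refl = refl

≤C-interval : ∀ {c₁ c₂ c₃ c₄ z} → c₁ ≤C z → c₂ ≤C z → z ≤C c₃ → z ≤C c₄ → c₁ ≡ c₂ ⊎ c₃ ≡ c₄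
≤C-interval {z = z} c₁≤z c₂≤z z≤c₃ z≤c₄ with level z
... | inj₁ lz = inj₁ (trans (≤lower⇒≡ lz c₁≤z) (sym (≤lower⇒≡ lz c₂≤z)))
... | inj₂ uz = inj₂ (trans (upper≤⇒≡ uz z≤c₃) (sym (upper≤⇒≡ uz z≤c₄)))

corner : ∀ {X : Set} → X → X → X → X → Crown → X
corner a b v w ca = a
corner a b v w cb = b
corner a b v w cv = v
corner a b v w cw = w

OneOf₄ : ∀ {X : Set} → X → X → X → X → X → Set
OneOf₄ a b v w y = y ≡ a ⊎ y ≡ b ⊎ y ≡ v ⊎ y ≡ w

corner-oneOf : ∀ {X : Set} {a b v w : X} c → OneOf₄ a b v w (corner a b v w c)
corner-oneOf ca = inj₁ refl
corner-oneOf cb = inj₂ (inj₁ refl)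
corner-oneOf cv = inj₂ (inj₂ (inj₁ refl))
corner-oneOf cw = inj₂ (inj₂ (inj₂ refl))

corner-onto : ∀ {X : Set} {a b v w y : X} → OneOf₄ a b v w y → ∃ λ c → corner a b v w c ≡ y
corner-onto (inj₁ refl)                 = ca , refl
corner-onto (inj₂ (inj₁ refl))          = cb , refl
corner-onto (inj₂ (inj₂ (inj₁ refl)))   = cv , refl
corner-onto (inj₂ (inj₂ (inj₂ refl)))   = cw , refl

minimal-below : ∀ {n} {_≼_ : Fin n → Fin n → Set} → IsPartialOrder _≡_ _≼_ → Decidable _≼_
              → ∀ x → ∃ λ m → m ≼ x × InL _≼_ m
minimal-below {_≼_ = _≼_} po _≼?_ x = go x (po-wellFounded po x)
  where
  open IsPartialOrder po using () renaming (refl to ≼-refl; trans to ≼-trans)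
  go : ∀ x → Acc (_<_ _≼_) x → ∃ λ m → m ≼ x × InL _≼_ m
  go x (acc below) with any? (λ y → y ≼? x ×-dec ¬? (y ≟ᶠ x))
  ... | yes (y , y<x) = let m , m≼y , m-min = go y (below y<x) in m , ≼-trans m≼y (proj₁ y<x) , m-min
  ... | no ∄y<x = x , ≼-refl , λ y y≼x → decidable-stable (y ≟ᶠ x) (λ y≢x → ∄y<x (y , y≼x , y≢x))

isolated : ∀ {n} {_≼_ : Fin n → Fin n → Set} {x y} → InL _≼_ x → InU _≼_ x
         → Star (Comp _≼_) x y → y ≡ x
isolated x-min x-max ε = refl
isolated x-min x-max (inj₁ x≼z ◅ path) with x-max _ x≼z
... | refl = isolated x-min x-max path
isolated x-min x-max (inj₂ z≼x ◅ path) with x-min _ z≼x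
... | refl = isolated x-min x-max path

minimal-not-maximal : ∀ {n} {_≼_ : Fin n → Fin n → Set} → Connected _≼_ → 2 ≤ n
                    → ∀ {x} → InL _≼_ x → InU _≼_ x → ⊥
minimal-not-maximal conn (s≤s (s≤s _)) {x} x-min x-max =
  punchInᵢ≢i x zero (isolated x-min x-max (conn x (punchIn x zero)))

module ConnectedPoset {n : ℕ} {_≼_ : Fin n → Fin n → Set}
  (po : IsPartialOrder _≡_ _≼_) (_≼?_ : Decidable _≼_) (conn : Connected _≼_) (two : 2 ≤ n) where

  open IsPartialOrder po using (antisym) renaming (refl to ≼-refl; reflexive to ≼-reflexive; trans to ≼-trans)

  Minimal Maximal : Fin n → Set
  Minimal = InL _≼_
  Maximal = InU _≼_

  minimal? : Decidable₁ Minimal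
  minimal? x = all? (λ y → y ≼? x →-dec (y ≟ᶠ x))

  maximal? : Decidable₁ Maximal
  maximal? x = all? (λ y → x ≼? y →-dec (y ≟ᶠ x))

  maximal-above : ∀ x → ∃ λ m → x ≼ m × Maximal m
  maximal-above = minimal-below (Flip.isPartialOrder po) (flip _≼?_)

  exclusive : ∀ {x} → Minimal x → Maximal x → ⊥
  exclusive = minimal-not-maximal conn two

  minimal-comparable : ∀ {x y} → Minimal x → Minimal y → Comp _≼_ x y → x ≡ y
  minimal-comparable _     y-min (inj₁ x≼y) = y-min _ x≼y
  minimal-comparable x-min _     (inj₂ y≼x) = sym (x-min _ y≼x)

  maximal-comparable : ∀ {x y} → Maximal x → Maximal y → Comp _≼_ x y → x ≡ y
  maximal-comparable x-max _     (inj₁ x≼y) = sym (x-max _ x≼y)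
  maximal-comparable _     y-max (inj₂ y≼x) = y-max _ y≼x

  crown-extremal : ∀ {a b v w} → IsCrown4 _≼_ a b v w
                 → InE _≼_ a → InE _≼_ b → InE _≼_ v → InE _≼_ w
                 → Minimal a × Minimal b × Maximal v × Maximal w
  crown-extremal ((_ , a≢v , a≢w , b≢v , _) , (a≼v , a≼w , b≼v , _) , _) ea eb ev ew =
      fromInj₁ (λ a-max → ⊥-elim (a≢v (sym (a-max _ a≼v)))) ea
    , fromInj₁ (λ b-max → ⊥-elim (b≢v (sym (b-max _ b≼v)))) eb
    , fromInj₂ (λ v-min → ⊥-elim (a≢v (v-min _ a≼v))) ev
    , fromInj₂ (λ w-min → ⊥-elim (a≢w (w-min _ a≼w))) ew

  meets-minimal : ∀ {N a b v w} → (∀ {x} → x ∈ N → Minimal x) → Maximal v → Maximal w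
                → Meets _≼_ a b v w N → a ∈ N ⊎ b ∈ N
  meets-minimal _     _     _     (inj₁ a∈N)                 = inj₁ a∈N
  meets-minimal _     _     _     (inj₂ (inj₁ b∈N))          = inj₂ b∈N
  meets-minimal N-min v-max _     (inj₂ (inj₂ (inj₁ v∈N))) = ⊥-elim (exclusive (N-min v∈N) v-max)
  meets-minimal N-min _     w-max (inj₂ (inj₂ (inj₂ w∈N))) = ⊥-elim (exclusive (N-min w∈N) w-max)

  meets-maximal : ∀ {N a b v w} → (∀ {x} → x ∈ N → Maximal x) → Minimal a → Minimal b
                → Meets _≼_ a b v w N → v ∈ N ⊎ w ∈ N
  meets-maximal N-max a-min _     (inj₁ a∈N)                 = ⊥-elim (exclusive a-min (N-max a∈N))
  meets-maximal N-max _     b-min (inj₂ (inj₁ b∈N))          = ⊥-elim (exclusive b-min (N-max b∈N))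
  meets-maximal _     _     _     (inj₂ (inj₂ (inj₁ v∈N))) = inj₁ v∈N
  meets-maximal _     _     _     (inj₂ (inj₂ (inj₂ w∈N))) = inj₂ w∈N

  corner-mono : ∀ {a b v w} → a ≼ v → a ≼ w → b ≼ v → b ≼ w
              → ∀ {c d} → c ≤C d → corner a b v w c ≼ corner a b v w d
  corner-mono _   _   _   _   ≤C-refl = ≼-refl
  corner-mono a≼v _   _   _   a≤v     = a≼v
  corner-mono _   a≼w _   _   a≤w     = a≼w
  corner-mono _   _   b≼v _   b≤v     = b≼v
  corner-mono _   _   _   b≼w b≤w     = b≼w

  corner-reflects : ∀ {a b v w} → IsCrown4 _≼_ a b v w
                  → ∀ {c d} → corner a b v w c ≼ corner a b v w d → c ≤C d
  corner-reflects _ {ca} {ca} _ = ≤C-refl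
  corner-reflects _ {ca} {cv} _ = a≤v
  corner-reflects _ {ca} {cw} _ = a≤w
  corner-reflects _ {cb} {cb} _ = ≤C-refl
  corner-reflects _ {cb} {cv} _ = b≤v
  corner-reflects _ {cb} {cw} _ = b≤w
  corner-reflects _ {cv} {cv} _ = ≤C-refl
  corner-reflects _ {cw} {cw} _ = ≤C-refl
  corner-reflects (_ , _ , a⊥b , _) {ca} {cb} a≼b = ⊥-elim (a⊥b (inj₁ a≼b))
  corner-reflects (_ , _ , a⊥b , _) {cb} {ca} b≼a = ⊥-elim (a⊥b (inj₂ b≼a))
  corner-reflects (_ , _ , _ , v⊥w) {cv} {cw} v≼w = ⊥-elim (v⊥w (inj₁ v≼w))
  corner-reflects (_ , _ , _ , v⊥w) {cw} {cv} w≼v = ⊥-elim (v⊥w (inj₂ w≼v))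
  corner-reflects ((_ , a≢v , _) , (a≼v , _) , _) {cv} {ca} v≼a = ⊥-elim (a≢v (antisym a≼v v≼a))
  corner-reflects ((_ , _ , a≢w , _) , (_ , a≼w , _) , _) {cw} {ca} w≼a = ⊥-elim (a≢w (antisym a≼w w≼a))
  corner-reflects ((_ , _ , _ , b≢v , _) , (_ , _ , b≼v , _) , _) {cv} {cb} v≼b = ⊥-elim (b≢v (antisym b≼v v≼b))
  corner-reflects ((_ , _ , _ , _ , b≢w , _) , (_ , _ , _ , b≼w) , _) {cw} {cb} w≼b = ⊥-elim (b≢w (antisym b≼w w≼b))

  corner-injective : ∀ {a b v w} → IsCrown4 _≼_ a b v w
                   → ∀ {c d} → corner a b v w c ≡ corner a b v w d → c ≡ d
  corner-injective crown eq =
    ≤C-antisym (corner-reflects crown (≼-reflexive eq)) (corner-reflects crown (≼-reflexive (sym eq)))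

  retract-swapˡ : ∀ {a b v w} → IsRetractOf4 _≼_ a b v w → IsRetractOf4 _≼_ b a v w
  retract-swapˡ (r , r-mono , r-idem , r-image , r-onto) =
    r , r-mono , r-idem , (λ y → swap₁₂ ∘ r-image y) , (λ y → r-onto y ∘ swap₁₂)

  retract-swapʳ : ∀ {a b v w} → IsRetractOf4 _≼_ a b v w → IsRetractOf4 _≼_ a b w v
  retract-swapʳ (r , r-mono , r-idem , r-image , r-onto) =
    r , r-mono , r-idem , (λ y → swap₃₄ ∘ r-image y) , (λ y → r-onto y ∘ swap₃₄)

  split-isPartition₂ : ∀ {S Q : Fin n → Set} (S? : Decidable₁ S) (Q? : Decidable₁ Q)
    → (∃ λ x → S x × ¬ Q x) → (∃ λ x → S x × Q x)
    → IsPartition₂ _≼_ S (subset (λ x → S? x ×-dec ¬? (Q? x))) (subset (λ x → S? x ×-dec Q? x))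
  split-isPartition₂ {S} {Q} S? Q? (x , Sx , ¬Qx) (y , Sy , Qy) =
      (λ _ → proj₁ ∘ ∈-subset⁻ X?) , (λ _ → proj₁ ∘ ∈-subset⁻ Y?)
    , (λ z Sz → map (λ ¬Qz → ∈-subset⁺ X? (Sz , ¬Qz)) (λ Qz → ∈-subset⁺ Y? (Sz , Qz)) (swap (toSum (Q? z))))
    , (λ _ z∈X z∈Y → proj₂ (∈-subset⁻ X? z∈X) (proj₂ (∈-subset⁻ Y? z∈Y)))
    , (x , ∈-subset⁺ X? (Sx , ¬Qx)) , (y , ∈-subset⁺ Y? (Sy , Qy))
    where
    X? : Decidable₁ (λ z → S z × ¬ Q z)
    X? z = S? z ×-dec ¬? (Q? z)
    Y? : Decidable₁ (λ z → S z × Q z)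
    Y? z = S? z ×-dec Q? z

  Over Under : Subset n → Fin n → Set
  Over  N x = ∃ λ m → m ∈ N × m ≼ x
  Under N x = ∃ λ m → m ∈ N × x ≼ m

  over? : ∀ N → Decidable₁ (Over N)
  over? N x = any? (λ m → m ∈? N ×-dec m ≼? x)

  under? : ∀ N → Decidable₁ (Under N)
  under? N x = any? (λ m → m ∈? N ×-dec x ≼? m)

  over-mono : ∀ {N x y} → Over N x → x ≼ y → Over N y
  over-mono (m , m∈N , m≼x) x≼y = m , m∈N , ≼-trans m≼x x≼y

  under-mono : ∀ {N x y} → Under N y → x ≼ y → Under N x
  under-mono (m , m∈N , y≼m) x≼y = m , m∈N , ≼-trans x≼y y≼m

  minimal-over : ∀ {N x} → Minimal x → Over N x → x ∈ N
  minimal-over x-min (m , m∈N , m≼x) = subst (_∈ _) (x-min m m≼x) m∈N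

  module Partition₂ {S : Fin n → Set} {X Y : Subset n} (p : IsPartition₂ _≼_ S X Y) where
    ⊆ˡ : ∀ x → x ∈ X → S x
    ⊆ˡ = proj₁ p
    ⊆ʳ : ∀ x → x ∈ Y → S x
    ⊆ʳ = proj₁ (proj₂ p)
    cover : ∀ x → S x → x ∈ X ⊎ x ∈ Y
    cover = proj₁ (proj₂ (proj₂ p))
    disjoint : ∀ x → x ∈ X → x ∈ Y → ⊥
    disjoint = proj₁ (proj₂ (proj₂ (proj₂ p)))
    nonemptyˡ : Nonempty X
    nonemptyˡ = proj₁ (proj₂ (proj₂ (proj₂ (proj₂ p))))
    nonemptyʳ : Nonempty Y
    nonemptyʳ = proj₂ (proj₂ (proj₂ (proj₂ (proj₂ p))))

  module Partitioned (A B V W : Subset n) (good : GoodPartition _≼_ A B V W) where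

    open Partition₂ (proj₁ good) renaming
      (⊆ˡ to A⊆Minimal; ⊆ʳ to B⊆Minimal; cover to Minimal⊆A∪B; disjoint to A∩B=∅;
       nonemptyˡ to A≠∅; nonemptyʳ to B≠∅)
    open Partition₂ (proj₁ (proj₂ good)) renaming
      (⊆ˡ to V⊆Maximal; ⊆ʳ to W⊆Maximal; cover to Maximal⊆V∪W; disjoint to V∩W=∅;
       nonemptyˡ to V≠∅; nonemptyʳ to W≠∅)

    no-improper : NoImproperCrown _≼_ A B V W
    no-improper = proj₂ (proj₂ good)

    Part : Crown → Subset n
    Part ca = A
    Part cb = B
    Part cv = V
    Part cw = W

    part-nonempty : ∀ c → Nonempty (Part c)
    part-nonempty ca = A≠∅
    part-nonempty cb = B≠∅
    part-nonempty cv = V≠∅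
    part-nonempty cw = W≠∅

    part-minimal : ∀ {c x} → Lower c → x ∈ Part c → Minimal x
    part-minimal ca-lower = A⊆Minimal _
    part-minimal cb-lower = B⊆Minimal _

    part-maximal : ∀ {c x} → Upper c → x ∈ Part c → Maximal x
    part-maximal cv-upper = V⊆Maximal _
    part-maximal cw-upper = W⊆Maximal _

    part-unique : ∀ {c d x} → x ∈ Part c → x ∈ Part d → c ≡ d
    part-unique {c} {d} x∈c x∈d with level c | level d
    ... | inj₁ lc | inj₂ ud = ⊥-elim (exclusive (part-minimal lc x∈c) (part-maximal ud x∈d))
    ... | inj₂ uc | inj₁ ld = ⊥-elim (exclusive (part-minimal ld x∈d) (part-maximal uc x∈c))
    ... | inj₁ ca-lower | inj₁ ca-lower = refl
    ... | inj₁ ca-lower | inj₁ cb-lower = ⊥-elim (A∩B=∅ _ x∈c x∈d)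
    ... | inj₁ cb-lower | inj₁ ca-lower = ⊥-elim (A∩B=∅ _ x∈d x∈c)
    ... | inj₁ cb-lower | inj₁ cb-lower = refl
    ... | inj₂ cv-upper | inj₂ cv-upper = refl
    ... | inj₂ cv-upper | inj₂ cw-upper = ⊥-elim (V∩W=∅ _ x∈c x∈d)
    ... | inj₂ cw-upper | inj₂ cv-upper = ⊥-elim (V∩W=∅ _ x∈d x∈c)
    ... | inj₂ cw-upper | inj₂ cw-upper = refl

    part-distinct : ∀ c d {x y} → x ∈ Part c → y ∈ Part d → c ≢ d → x ≢ y
    part-distinct _ _ x∈c y∈d c≢d refl = c≢d (part-unique x∈c y∈d)

    same-part : ∀ {x y} → SameSet _≼_ A B V W x y → ∃ λ e → x ∈ Part e × y ∈ Part e
    same-part (inj₁ xy)                 = ca , xy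
    same-part (inj₂ (inj₁ xy))          = cb , xy
    same-part (inj₂ (inj₂ (inj₁ xy)))   = cv , xy
    same-part (inj₂ (inj₂ (inj₂ xy)))   = cw , xy

    separated : ∀ c d {x y} → x ∈ Part c → y ∈ Part d → c ≢ d → ¬ SameSet _≼_ A B V W x y
    separated _ _ x∈c y∈d c≢d same with same-part same
    ... | _ , x∈e , y∈e = c≢d (trans (part-unique x∈c x∈e) (part-unique y∈e y∈d))

    all-different : ∀ {a b v w} → a ∈ A → b ∈ B → v ∈ V → w ∈ W → AllDifferent _≼_ A B V W a b v w
    all-different a∈A b∈B v∈V w∈W =
        separated ca cb a∈A b∈B (λ ()) , separated ca cv a∈A v∈V (λ ()) , separated ca cw a∈A w∈W (λ ())
      , separated cb cv b∈B v∈V (λ ()) , separated cb cw b∈B w∈W (λ ()) , separated cv cw v∈V w∈W (λ ())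

    over-A-or-B : ∀ x → Over A x ⊎ Over B x
    over-A-or-B x with minimal-below po _≼?_ x
    ... | m , m≼x , m-min = map (λ m∈A → m , m∈A , m≼x) (λ m∈B → m , m∈B , m≼x) (Minimal⊆A∪B m m-min)

    under-V-or-W : ∀ x → Under V x ⊎ Under W x
    under-V-or-W x with maximal-above x
    ... | m , x≼m , m-max = map (λ m∈V → m , m∈V , x≼m) (λ m∈W → m , m∈W , x≼m) (Maximal⊆V∪W m m-max)

    no-straddle : ∀ {x} → Over A x → Over B x → Under V x → Under W x → ⊥
    no-straddle {x} (a , a∈A , a≼x) (b , b∈B , b≼x) (v , v∈V , x≼v) (w , w∈W , x≼w) =
      no-improper a b v w (inj₁ a-min) (inj₁ b-min) (inj₂ v-max) (inj₂ w-max)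
        (inj₁ a∈A) (inj₂ (inj₁ b∈B)) (inj₂ (inj₂ (inj₁ v∈V))) (inj₂ (inj₂ (inj₂ w∈W)))
        (crown , x , (a≼x , x≼v) , (b≼x , x≼w))
      where
      a-min : Minimal a
      a-min = A⊆Minimal a a∈A
      b-min : Minimal b
      b-min = B⊆Minimal b b∈B
      v-max : Maximal v
      v-max = V⊆Maximal v v∈V
      w-max : Maximal w
      w-max = W⊆Maximal w w∈W
      a≢b : a ≢ b
      a≢b = part-distinct ca cb a∈A b∈B (λ ())
      v≢w : v ≢ w
      v≢w = part-distinct cv cw v∈V w∈W (λ ())
      crown : IsCrown4 _≼_ a b v w
      crown =
          ( a≢b , part-distinct ca cv a∈A v∈V (λ ()) , part-distinct ca cw a∈A w∈W (λ ())
          , part-distinct cb cv b∈B v∈V (λ ()) , part-distinct cb cw b∈B w∈W (λ ()) , v≢w )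
        , (≼-trans a≼x x≼v , ≼-trans a≼x x≼w , ≼-trans b≼x x≼v , ≼-trans b≼x x≼w)
        , a≢b ∘ minimal-comparable a-min b-min
        , v≢w ∘ maximal-comparable v-max w-max

    data View (x : Fin n) : Crown → Set where
      in-V   : x ∈ V → View x cv
      in-W   : x ∉ V → x ∈ W → View x cw
      only-A : x ∉ V → x ∉ W → ¬ Over B x → View x ca
      only-B : x ∉ V → x ∉ W → Over B x → ¬ Over A x → View x cb
      both-V : x ∉ V → x ∉ W → Over B x → Over A x → ¬ Under W x → View x cv
      both-W : x ∉ V → x ∉ W → Over B x → Over A x → Under W x → View x cw

    classify : ∀ x → Σ Crown (View x)
    classify x with x ∈? V | x ∈? W | over? B x | over? A x | under? W x
    ... | yes x∈V | _       | _      | _      | _      = cv , in-V x∈V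
    ... | no x∉V  | yes x∈W | _      | _      | _      = cw , in-W x∉V x∈W
    ... | no x∉V  | no x∉W  | no ¬oB | _      | _      = ca , only-A x∉V x∉W ¬oB
    ... | no x∉V  | no x∉W  | yes oB | no ¬oA | _      = cb , only-B x∉V x∉W oB ¬oA
    ... | no x∉V  | no x∉W  | yes oB | yes oA | no ¬uW = cv , both-V x∉V x∉W oB oA ¬uW
    ... | no x∉V  | no x∉W  | yes oB | yes oA | yes uW = cw , both-W x∉V x∉W oB oA uW

    crown-map : Fin n → Crown
    crown-map x = proj₁ (classify x)

    view : ∀ x → View x (crown-map x)
    view x = proj₂ (classify x)

    view-part : ∀ c {x d} → x ∈ Part c → View x d → d ≡ c
    view-part ca _   (only-A _ _ _)         = refl
    view-part ca x∈A (in-V x∈V)             = ⊥-elim (part-distinct ca cv x∈A x∈V (λ ()) refl)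
    view-part ca x∈A (in-W _ x∈W)           = ⊥-elim (part-distinct ca cw x∈A x∈W (λ ()) refl)
    view-part ca x∈A (only-B _ _ oB _)      = ⊥-elim (A∩B=∅ _ x∈A (minimal-over (A⊆Minimal _ x∈A) oB))
    view-part ca x∈A (both-V _ _ oB _ _)    = ⊥-elim (A∩B=∅ _ x∈A (minimal-over (A⊆Minimal _ x∈A) oB))
    view-part ca x∈A (both-W _ _ oB _ _)    = ⊥-elim (A∩B=∅ _ x∈A (minimal-over (A⊆Minimal _ x∈A) oB))
    view-part cb _   (only-B _ _ _ _)       = refl
    view-part cb x∈B (in-V x∈V)             = ⊥-elim (part-distinct cb cv x∈B x∈V (λ ()) refl)
    view-part cb x∈B (in-W _ x∈W)           = ⊥-elim (part-distinct cb cw x∈B x∈W (λ ()) refl)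
    view-part cb x∈B (only-A _ _ ¬oB)       = ⊥-elim (¬oB (_ , x∈B , ≼-refl))
    view-part cb x∈B (both-V _ _ _ oA _)    = ⊥-elim (A∩B=∅ _ (minimal-over (B⊆Minimal _ x∈B) oA) x∈B)
    view-part cb x∈B (both-W _ _ _ oA _)    = ⊥-elim (A∩B=∅ _ (minimal-over (B⊆Minimal _ x∈B) oA) x∈B)
    view-part cv _   (in-V _)               = refl
    view-part cv x∈V (in-W x∉V _)           = ⊥-elim (x∉V x∈V)
    view-part cv x∈V (only-A x∉V _ _)       = ⊥-elim (x∉V x∈V)
    view-part cv x∈V (only-B x∉V _ _ _)     = ⊥-elim (x∉V x∈V)
    view-part cv x∈V (both-V x∉V _ _ _ _)   = ⊥-elim (x∉V x∈V)
    view-part cv x∈V (both-W x∉V _ _ _ _)   = ⊥-elim (x∉V x∈V)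
    view-part cw x∈W (in-V x∈V)             = ⊥-elim (V∩W=∅ _ x∈V x∈W)
    view-part cw _   (in-W _ _)             = refl
    view-part cw x∈W (only-A _ x∉W _)       = ⊥-elim (x∉W x∈W)
    view-part cw x∈W (only-B _ x∉W _ _)     = ⊥-elim (x∉W x∈W)
    view-part cw x∈W (both-V _ x∉W _ _ _)   = ⊥-elim (x∉W x∈W)
    view-part cw x∈W (both-W _ x∉W _ _ _)   = ⊥-elim (x∉W x∈W)

    up-closed : ∀ {x y c d} → x ≼ y → Upper c → View x c → View y d → d ≡ c
    up-closed x≼y _ (in-V x∈V) vy =
      view-part cv (subst (_∈ V) (sym (V⊆Maximal _ x∈V _ x≼y)) x∈V) vy
    up-closed x≼y _ (in-W _ x∈W) vy =
      view-part cw (subst (_∈ W) (sym (W⊆Maximal _ x∈W _ x≼y)) x∈W) vy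
    up-closed _   _ (both-V _ _ _ _ _)    (in-V _)               = refl
    up-closed x≼y _ (both-V _ _ _ _ ¬uW)  (in-W _ y∈W)           = ⊥-elim (¬uW (_ , y∈W , x≼y))
    up-closed x≼y _ (both-V _ _ oB _ _)   (only-A _ _ ¬oB)       = ⊥-elim (¬oB (over-mono oB x≼y))
    up-closed x≼y _ (both-V _ _ _ oA _)   (only-B _ _ _ ¬oA)     = ⊥-elim (¬oA (over-mono oA x≼y))
    up-closed _   _ (both-V _ _ _ _ _)    (both-V _ _ _ _ _)     = refl
    up-closed x≼y _ (both-V _ _ _ _ ¬uW)  (both-W _ _ _ _ uW)    = ⊥-elim (¬uW (under-mono uW x≼y))
    up-closed x≼y _ (both-W _ _ oB oA uW) (in-V y∈V)             = ⊥-elim (no-straddle oA oB (_ , y∈V , x≼y) uW)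
    up-closed _   _ (both-W _ _ _ _ _)    (in-W _ _)             = refl
    up-closed x≼y _ (both-W _ _ oB _ _)   (only-A _ _ ¬oB)       = ⊥-elim (¬oB (over-mono oB x≼y))
    up-closed x≼y _ (both-W _ _ _ oA _)   (only-B _ _ _ ¬oA)     = ⊥-elim (¬oA (over-mono oA x≼y))
    up-closed {y = y} x≼y _ (both-W _ _ oB oA uW) (both-V _ _ _ _ ¬uWy) with under-V-or-W y
    ... | inj₁ uVy = ⊥-elim (no-straddle oA oB (under-mono uVy x≼y) uW)
    ... | inj₂ uWy = ⊥-elim (¬uWy uWy)
    up-closed _   _ (both-W _ _ _ _ _)    (both-W _ _ _ _ _)     = refl

    down-closed : ∀ {x y c d} → x ≼ y → Lower c → Lower d → View x c → View y d → c ≡ d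
    down-closed _ ca-lower ca-lower _ _ = refl
    down-closed _ cb-lower cb-lower _ _ = refl
    down-closed {x} x≼y ca-lower cb-lower (only-A _ _ ¬oB) (only-B _ _ _ ¬oA) with over-A-or-B x
    ... | inj₁ oA = ⊥-elim (¬oA (over-mono oA x≼y))
    ... | inj₂ oB = ⊥-elim (¬oB oB)
    down-closed x≼y cb-lower ca-lower (only-B _ _ oB _) (only-A _ _ ¬oB) = ⊥-elim (¬oB (over-mono oB x≼y))

    crown-map-mono : ∀ {x y} → x ≼ y → crown-map x ≤C crown-map y
    crown-map-mono {x} {y} x≼y with level (crown-map x) | level (crown-map y)
    ... | inj₂ ux | _       = ≤C-reflexive (sym (up-closed x≼y ux (view x) (view y)))
    ... | inj₁ lx | inj₁ ly = ≤C-reflexive (down-closed x≼y lx ly (view x) (view y))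
    ... | inj₁ lx | inj₂ uy = lower≤upper lx uy

    crown-map-part : ∀ c {x} → x ∈ Part c → crown-map x ≡ c
    crown-map-part c {x} x∈c = view-part c x∈c (view x)

    crown-map-onto : ∀ c → ∃ λ x → crown-map x ≡ c
    crown-map-onto c = let x , x∈c = part-nonempty c in x , crown-map-part c x∈c

    retract : ∀ {a b v w} → a ∈ A → b ∈ B → v ∈ V → w ∈ W
            → a ≼ v → a ≼ w → b ≼ v → b ≼ w → IsRetractOf4 _≼_ a b v w
    retract {a} {b} {v} {w} a∈A b∈B v∈V w∈W a≼v a≼w b≼v b≼w =
        ψ ∘ crown-map
      , (λ x≼y → corner-mono a≼v a≼w b≼v b≼w (crown-map-mono x≼y))
      , (λ x → cong ψ (section (crown-map x)))
      , (λ { _ (x , refl) → corner-oneOf (crown-map x) })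
      , λ y y∈ → let c , ψc≡y = corner-onto y∈ in ψ c , trans (cong ψ (section c)) ψc≡y
      where
      ψ : Crown → Fin n
      ψ = corner a b v w
      ψ∈Part : ∀ c → ψ c ∈ Part c
      ψ∈Part ca = a∈A
      ψ∈Part cb = b∈B
      ψ∈Part cv = v∈V
      ψ∈Part cw = w∈W
      section : ∀ c → crown-map (ψ c) ≡ c
      section c = crown-map-part c (ψ∈Part c)

    separated⇒retract : ∀ {a b v w} → IsCrown4 _≼_ a b v w
                      → Minimal a → Minimal b → Maximal v → Maximal w
                      → AllDifferent _≼_ A B V W a b v w → IsRetractOf4 _≼_ a b v w
    separated⇒retract (_ , (a≼v , a≼w , b≼v , b≼w) , _) a-min b-min v-max w-max
                      (¬ab , _ , _ , _ , _ , ¬vw)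
      with split-pair (Minimal⊆A∪B _ a-min) (Minimal⊆A∪B _ b-min) (¬ab ∘ inj₁) (¬ab ∘ inj₂ ∘ inj₁)
         | split-pair (Maximal⊆V∪W _ v-max) (Maximal⊆V∪W _ w-max)
                      (¬vw ∘ inj₂ ∘ inj₂ ∘ inj₁) (¬vw ∘ inj₂ ∘ inj₂ ∘ inj₂)
    ... | inj₁ (a∈A , b∈B) | inj₁ (v∈V , w∈W) = retract a∈A b∈B v∈V w∈W a≼v a≼w b≼v b≼w
    ... | inj₂ (a∈B , b∈A) | inj₁ (v∈V , w∈W) = retract-swapˡ (retract b∈A a∈B v∈V w∈W b≼v b≼w a≼v a≼w)
    ... | inj₁ (a∈A , b∈B) | inj₂ (v∈W , w∈V) = retract-swapʳ (retract a∈A b∈B w∈V v∈W a≼w a≼v b≼w b≼v)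
    ... | inj₂ (a∈B , b∈A) | inj₂ (v∈W , w∈V) =
      retract-swapˡ (retract-swapʳ (retract b∈A a∈B w∈V v∈W b≼w b≼v a≼w a≼v))

  module FromHom (f : Fin n → Crown) (f-mono : ∀ {x y} → x ≼ y → f x ≤C f y)
                 (f-onto : ∀ c → ∃ λ x → f x ≡ c) where

    A? : Decidable₁ (λ x → Minimal x × f x ≢ cb)
    B? : Decidable₁ (λ x → Minimal x × f x ≡ cb)
    V? : Decidable₁ (λ x → Maximal x × f x ≢ cw)
    W? : Decidable₁ (λ x → Maximal x × f x ≡ cw)
    A? x = minimal? x ×-dec ¬? (f x ≟ᶜ cb)
    B? x = minimal? x ×-dec f x ≟ᶜ cb
    V? x = maximal? x ×-dec ¬? (f x ≟ᶜ cw)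
    W? x = maximal? x ×-dec f x ≟ᶜ cw

    A B V W : Subset n
    A = subset A?
    B = subset B?
    V = subset V?
    W = subset W?

    minimal-preimage : ∀ {c} → Lower c → ∃ λ x → Minimal x × f x ≡ c
    minimal-preimage {c} lc with f-onto c
    ... | p , fp≡c with minimal-below po _≼?_ p
    ... | m , m≼p , m-min = m , m-min , ≤lower⇒≡ lc (subst (f m ≤C_) fp≡c (f-mono m≼p))

    maximal-preimage : ∀ {c} → Upper c → ∃ λ x → Maximal x × f x ≡ c
    maximal-preimage {c} uc with f-onto c
    ... | p , fp≡c with maximal-above p
    ... | m , p≼m , m-max = m , m-max , upper≤⇒≡ uc (subst (_≤C f m) fp≡c (f-mono p≼m))

    avoiding : ∀ {c d} {S : Fin n → Set} → c ≢ d → (∃ λ x → S x × f x ≡ c) → ∃ λ x → S x × f x ≢ d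
    avoiding c≢d (x , Sx , fx≡c) = x , Sx , c≢d ∘ trans (sym fx≡c)

    meets-minimal-subset : ∀ {Q : Fin n → Set} {a b v w} (N? : Decidable₁ (λ x → Minimal x × Q x))
                         → Maximal v → Maximal w → Meets _≼_ a b v w (subset N?) → Q a ⊎ Q b
    meets-minimal-subset N? v-max w-max =
      map (proj₂ ∘ ∈-subset⁻ N?) (proj₂ ∘ ∈-subset⁻ N?) ∘ meets-minimal (proj₁ ∘ ∈-subset⁻ N?) v-max w-max

    meets-maximal-subset : ∀ {Q : Fin n → Set} {a b v w} (N? : Decidable₁ (λ x → Maximal x × Q x))
                         → Minimal a → Minimal b → Meets _≼_ a b v w (subset N?) → Q v ⊎ Q w
    meets-maximal-subset N? a-min b-min =
      map (proj₂ ∘ ∈-subset⁻ N?) (proj₂ ∘ ∈-subset⁻ N?) ∘ meets-maximal (proj₁ ∘ ∈-subset⁻ N?) a-min b-min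

    no-improper : NoImproperCrown _≼_ A B V W
    no-improper a b v w ea eb ev ew meets-A meets-B meets-V meets-W (crown , z , (a≼z , z≼v) , (b≼z , z≼w))
      with crown-extremal crown ea eb ev ew
    ... | a-min , b-min , v-max , w-max
      with ≤C-interval (f-mono a≼z) (f-mono b≼z) (f-mono z≼v) (f-mono z≼w)
    ... | inj₁ fa≡fb =
      split-absurd fa≡fb (meets-minimal-subset A? v-max w-max meets-A) (meets-minimal-subset B? v-max w-max meets-B)
    ... | inj₂ fv≡fw =
      split-absurd fv≡fw (meets-maximal-subset V? a-min b-min meets-V) (meets-maximal-subset W? a-min b-min meets-W)

    good : GoodPartition _≼_ A B V W
    good =
        split-isPartition₂ minimal? (λ x → f x ≟ᶜ cb) (avoiding (λ ()) (minimal-preimage ca-lower)) (minimal-preimage cb-lower)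
      , split-isPartition₂ maximal? (λ x → f x ≟ᶜ cw) (avoiding (λ ()) (maximal-preimage cv-upper)) (maximal-preimage cw-upper)
      , no-improper

  HasGoodPartition : Set
  HasGoodPartition = Σ (Subset n) λ A → Σ (Subset n) λ B → Σ (Subset n) λ V → Σ (Subset n) λ W →
                       GoodPartition _≼_ A B V W

  HasSeparatingPartition : Fin n → Fin n → Fin n → Fin n → Set
  HasSeparatingPartition a b v w = Σ (Subset n) λ A → Σ (Subset n) λ B → Σ (Subset n) λ V → Σ (Subset n) λ W →
                                     GoodPartition _≼_ A B V W × AllDifferent _≼_ A B V W a b v w

  hom⇒partition : SurjHomToCrown _≼_ → HasGoodPartition
  hom⇒partition (f , f-mono , f-onto) = A , B , V , W , good
    where open FromHom f f-mono f-onto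

  partition⇒hom : HasGoodPartition → SurjHomToCrown _≼_
  partition⇒hom (A , B , V , W , good) = crown-map , crown-map-mono , crown-map-onto
    where open Partitioned A B V W good

  retract⇒partition : ∀ {a b v w} → IsCrown4 _≼_ a b v w
                    → Minimal a → Minimal b → Maximal v → Maximal w
                    → IsRetractOf4 _≼_ a b v w → HasSeparatingPartition a b v w
  retract⇒partition {a} {b} {v} {w} crown a-min b-min v-max w-max (r , r-mono , r-idem , r-image , r-onto) =
      A , B , V , W , good
    , all-different (∈-subset⁺ A? (a-min , (λ ()) ∘ trans (sym (f-corner ca)))) (∈-subset⁺ B? (b-min , f-corner cb))
                    (∈-subset⁺ V? (v-max , (λ ()) ∘ trans (sym (f-corner cv)))) (∈-subset⁺ W? (w-max , f-corner cw))
    where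
    coordinate : ∀ x → ∃ λ c → corner a b v w c ≡ r x
    coordinate x = corner-onto (r-image (r x) (x , refl))

    f : Fin n → Crown
    f x = proj₁ (coordinate x)

    f-mono : ∀ {x y} → x ≼ y → f x ≤C f y
    f-mono {x} {y} x≼y =
      corner-reflects crown (subst₂ _≼_ (sym (proj₂ (coordinate x))) (sym (proj₂ (coordinate y))) (r-mono x≼y))

    r-fixes : ∀ c → r (corner a b v w c) ≡ corner a b v w c
    r-fixes c with r-onto (corner a b v w c) (corner-oneOf c)
    ... | x , rx≡ = trans (cong r (sym rx≡)) (trans (r-idem x) rx≡)

    f-corner : ∀ c → f (corner a b v w c) ≡ c
    f-corner c = corner-injective crown (trans (proj₂ (coordinate (corner a b v w c))) (r-fixes c))

    open FromHom f f-mono (λ c → corner a b v w c , f-corner c)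
    open Partitioned A B V W good using (all-different)

  partition⇒retract : ∀ {a b v w} → IsCrown4 _≼_ a b v w
                    → Minimal a → Minimal b → Maximal v → Maximal w
                    → HasSeparatingPartition a b v w → IsRetractOf4 _≼_ a b v w
  partition⇒retract crown a-min b-min v-max w-max (A , B , V , W , good , separating) =
    Partitioned.separated⇒retract A B V W good crown a-min b-min v-max w-max separating

lemma2 : (n : ℕ) (_≼_ : Fin n → Fin n → Set)
    → IsPartialOrder _≡_ _≼_ → Decidable _≼_
    → Connected _≼_ → 2 ≤ n
    → (SurjHomToCrown _≼_
         ⇔ Σ (Subset n) λ A → Σ (Subset n) λ B → Σ (Subset n) λ V → Σ (Subset n) λ W →
             GoodPartition _≼_ A B V W)
      × (∀ a b v w → IsCrown4 _≼_ a b v w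
           → InE _≼_ a → InE _≼_ b → InE _≼_ v → InE _≼_ w
           → (IsRetractOf4 _≼_ a b v w
               ⇔ Σ (Subset n) λ A → Σ (Subset n) λ B → Σ (Subset n) λ V → Σ (Subset n) λ W →
                   GoodPartition _≼_ A B V W × AllDifferent _≼_ A B V W a b v w))
lemma2 n _≼_ po dec conn two =
    mk⇔ hom⇒partition partition⇒hom
  , λ a b v w crown ea eb ev ew →
      let a-min , b-min , v-max , w-max = crown-extremal crown ea eb ev ew in
      mk⇔ (retract⇒partition crown a-min b-min v-max w-max) (partition⇒retract crown a-min b-min v-max w-max)
  where open ConnectedPoset po dec conn two
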